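{- For every $n\ge2$: $g_{n,2}=C_{n-1}$; $g_{n,n}=n-1$; and $g_{n,i}=g_{n-1,i-1}+g_{n,i+1}$ for $3\le i\le n-1$.
   Context: $S_n(321)$ is the set of permutations $\pi=\pi_1\cdots\pi_n$ of $\{1,\dots,n\}$ avoiding $321$ (no $a<b<c$ with $\pi_a>\pi_b>\pi_c$). An entry $\pi_i$ is a left-to-right (LTR) maximum if $\pi_i>\pi_j$ for all $j<i$. For $n\ge1$ and $2\le i\le n$, $g_{n,i}$ is the number of $\pi\in S_n(321)$ such that $\pi_i$ is not an LTR maximum and $\pi_j$ is an LTR maximum for every $j<i$; also $g_{n,n+1}=1$ (counting only the identity). $C_r=\frac{1}{r+1}\binom{2r}{r}$ is the $r$-th Catalan number. -}

module Defs where

open import Data.Nat using (ℕ; zero; suc; _+_; _∸_; _/_; _≡ᵇ_)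
import Data.Nat.Properties as ℕP
open import Data.Nat.Combinatorics using (_C_)
open import Data.Fin using (Fin; toℕ; _<_; _>_; _≟_)
open import Data.Fin.Properties using (all?; any?; _<?_)
open import Data.Vec using (Vec; []; _∷_; lookup)
open import Data.List using (List; [_]; map; concatMap; allFin; filter; length)
open import Data.Product using (_×_; ∃)
open import Relation.Binary.PropositionalEquality using (_≡_)
open import Relation.Nullary using (¬_; Dec)
open import Relation.Nullary.Decidable using (_×-dec_; _→-dec_; ¬?)

catalan : ℕ → ℕ
catalan r = ((r + r) C r) / suc r

-- A word of length n over {0,…,n-1}, i.e. a candidate one-line notation π₁⋯πₙ
-- (positions and values are 0-based Fin n; π_{k+1} = lookup v k).
Word : ℕ → Set
Word n = Vec (Fin n) n

allVecs : (n m : ℕ) → List (Vec (Fin n) m)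
allVecs n zero    = [ [] ]
allVecs n (suc m) = concatMap (λ x → map (x ∷_) (allVecs n m)) (allFin n)

IsPerm : ∀ {n} → Word n → Set
IsPerm {n} v = (a b : Fin n) → lookup v a ≡ lookup v b → a ≡ b

isPerm? : ∀ {n} (v : Word n) → Dec (IsPerm v)
isPerm? v = all? λ a → all? λ b → (lookup v a ≟ lookup v b) →-dec (a ≟ b)

Has321 : ∀ {n} → Word n → Set
Has321 {n} v = ∃ λ (a : Fin n) → ∃ λ (b : Fin n) → ∃ λ (c : Fin n) →
  a < b × b < c × lookup v a > lookup v b × lookup v b > lookup v c

has321? : ∀ {n} (v : Word n) → Dec (Has321 v)
has321? v = any? λ a → any? λ b → any? λ c →
  (a <? b) ×-dec (b <? c) ×-dec (lookup v b <? lookup v a) ×-dec (lookup v c <? lookup v b)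

Avoids321 : ∀ {n} → Word n → Set
Avoids321 v = ¬ Has321 v

LTRMax : ∀ {n} → Word n → Fin n → Set
LTRMax {n} v j = (k : Fin n) → k < j → lookup v k < lookup v j

ltrMax? : ∀ {n} (v : Word n) (j : Fin n) → Dec (LTRMax v j)
ltrMax? v j = all? λ k → (k <? j) →-dec (lookup v k <? lookup v j)

-- property defining g_{n,i} (1-based i): entries π_j with j < i are LTR maxima,
-- and π_i is not an LTR maximum (vacuous when i = n+1).
GProp : ∀ {n} → ℕ → Word n → Set
GProp {n} i v =
  ((j : Fin n) → suc (toℕ j) Data.Nat.< i → LTRMax v j) ×
  ((j : Fin n) → suc (toℕ j) ≡ i → ¬ LTRMax v j)

gProp? : ∀ {n} (i : ℕ) (v : Word n) → Dec (GProp i v)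
gProp? i v =
  (all? λ j → (suc (toℕ j) ℕP.<? i) →-dec ltrMax? v j) ×-dec
  (all? λ j → (suc (toℕ j) ℕP.≟ i) →-dec ¬? (ltrMax? v j))

Counted : ∀ {n} → ℕ → Word n → Set
Counted i v = IsPerm v × Avoids321 v × GProp i v

counted? : ∀ {n} (i : ℕ) (v : Word n) → Dec (Counted i v)
counted? i v = isPerm? v ×-dec ¬? (has321? v) ×-dec gProp? i v

g : ℕ → ℕ → ℕ
g n i = length (filter (counted? i) (allVecs n n))

module Submission where

-- Split a permutation π ∈ S_{m+1}(321) into its first entry y and the standardisation w of the rest.
-- Then π avoids 321 iff w does and every entry of w below y is a right-to-left minimum, so it is natural
-- to count A(m, t) = #Good m t 0 = #{π ∈ S_m(321) : every value below t is a right-to-left minimum}.  The split gives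
-- A(m+1, t+1) = A(m, t) + A(m+1, t+2), whence A(t+u, t) is the ballot number C(t+2u, u) - C(t+2u, u-1)
-- and A(m, 0) = C_m.  Demanding in addition t ≤ π₁ < ⋯ < π_K amounts to raising t to t + K, and g_{n,i}
-- counts the π whose first i - 1 entries increase but whose first i do not, so g_{n,i} = A(n-1, i-2).
-- The three claims are then boundary values and the recurrence of A.

open import Defs
open import Algebra.Properties.CommutativeMonoid.Sum as Σ using ()
open import Data.Empty using (⊥-elim)
open import Data.Fin as Fin using (Fin; zero; suc; toℕ; punchIn)
open import Data.Fin.Properties as Finₚ using (all?; _<?_)
open import Data.List as List using (List; []; _∷_; _++_; filter; length; tabulate; concatMap)
open import Data.List.Properties using (length-++; filter-++)
open import Data.Nat as ℕ using (ℕ; zero; suc; _+_; _*_; _∸_; _≤_; z≤n; s≤s)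
open import Data.Nat.Combinatorics using (_C_; nCk+nC[k+1]≡[n+1]C[k+1]; nC1≡n; nCk≡nC[n∸k]; k>n⇒nCk≡0)
open import Data.Nat.DivMod using (_/_; m*n/n≡m)
open import Data.Nat.Properties hiding (_<?_)
open import Data.Nat.Tactic.RingSolver using (solve-∀)
open import Data.Product using (_×_; _,_; proj₁; proj₂; ∃)
open import Data.Sum using (inj₁; inj₂)
open import Data.Vec as Vec using (Vec; []; _∷_; lookup)
open import Data.Vec.Properties using (lookup-map)
open import Function using (_∘_; _⇔_; mk⇔; Equivalence)
open import Relation.Binary.PropositionalEquality
open import Relation.Nullary using (yes; no; ¬_)
open import Relation.Nullary.Decidable using (_×-dec_; _→-dec_; ¬?)
open import Relation.Unary using (Decidable)
open import Relation.Unary.Properties using (_∩?_; ∁?)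

open import Algebra.Properties.CommutativeSemigroup +-commutativeSemigroup using (interchange; x∙yz≈y∙xz)

open Σ +-0-commutativeMonoid using (sum; sum-cong-≗; sum-remove)

private variable
  A B : Set
  n : ℕ

count : {P : A → Set} → Decidable P → List A → ℕ
count P? = length ∘ filter P?

count-cong : {P Q : A → Set} (P? : Decidable P) (Q? : Decidable Q) →
  (∀ x → P x ⇔ Q x) → ∀ xs → count P? xs ≡ count Q? xs
count-cong P? Q? P⇔Q [] = refl
count-cong P? Q? P⇔Q (x ∷ xs) with P? x | Q? x
... | yes _  | yes _  = cong suc (count-cong P? Q? P⇔Q xs)
... | no _   | no _   = count-cong P? Q? P⇔Q xs
... | yes p  | no ¬q  = ⊥-elim (¬q (Equivalence.to (P⇔Q x) p))
... | no ¬p  | yes q  = ⊥-elim (¬p (Equivalence.from (P⇔Q x) q))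

count-none : {P : A → Set} (P? : Decidable P) → (∀ x → ¬ P x) → ∀ xs → count P? xs ≡ 0
count-none P? ¬P [] = refl
count-none P? ¬P (x ∷ xs) with P? x
... | yes p = ⊥-elim (¬P x p)
... | no _  = count-none P? ¬P xs

count-++ : {P : A → Set} (P? : Decidable P) (xs ys : List A) → count P? (xs ++ ys) ≡ count P? xs + count P? ys
count-++ P? xs ys = trans (cong length (filter-++ P? xs ys)) (length-++ (filter P? xs))

count-map : {P : B → Set} (P? : Decidable P) (f : A → B) (xs : List A) → count P? (List.map f xs) ≡ count (P? ∘ f) xs
count-map P? f [] = refl
count-map P? f (x ∷ xs) with P? (f x)
... | yes _ = cong suc (count-map P? f xs)
... | no _  = count-map P? f xs

count-partition : {P Q : A → Set} (P? : Decidable P) (Q? : Decidable Q) (xs : List A) →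
  count P? xs ≡ count (P? ∩? Q?) xs + count (P? ∩? ∁? Q?) xs
count-partition P? Q? [] = refl
count-partition P? Q? (x ∷ xs) with P? x | Q? x
... | yes _ | yes _ = cong suc (count-partition P? Q? xs)
... | yes _ | no _  = trans (cong suc (count-partition P? Q? xs)) (sym (+-suc _ _))
... | no _  | _     = count-partition P? Q? xs

count-concatMap-tabulate : ∀ {n} {P : A → Set} (P? : Decidable P) (f : B → List A) (h : Fin n → B) →
  count P? (concatMap f (tabulate h)) ≡ sum (λ i → count P? (f (h i)))
count-concatMap-tabulate {n = zero}  P? f h = refl
count-concatMap-tabulate {n = suc n} P? f h =
  trans (count-++ P? (f (h zero)) _) (cong (count P? (f (h zero)) +_) (count-concatMap-tabulate P? f (h ∘ suc)))

-- sumFrom t k h = h t + h (t + 1) + ⋯ + h (k - 1)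
sumFrom : ℕ → ℕ → (ℕ → ℕ) → ℕ
sumFrom t       zero    h = 0
sumFrom zero    (suc k) h = h 0 + sumFrom 0 k (h ∘ suc)
sumFrom (suc t) (suc k) h = sumFrom t k (h ∘ suc)

sumFrom-step : ∀ {t k} h → t ℕ.< k → sumFrom t k h ≡ h t + sumFrom (suc t) k h
sumFrom-step {zero}  {suc k} h _         = refl
sumFrom-step {suc t} {suc k} h (s≤s t<k) = sumFrom-step (h ∘ suc) t<k

sumFrom-≡0 : ∀ t k h → (∀ y → t ≤ y → y ℕ.< k → h y ≡ 0) → sumFrom t k h ≡ 0
sumFrom-≡0 t       zero    h h≡0 = refl
sumFrom-≡0 zero    (suc k) h h≡0 =
  cong₂ _+_ (h≡0 0 z≤n (s≤s z≤n)) (sumFrom-≡0 0 k (h ∘ suc) λ y _ y<k → h≡0 (suc y) z≤n (s≤s y<k))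
sumFrom-≡0 (suc t) (suc k) h h≡0 = sumFrom-≡0 t k (h ∘ suc) λ y t≤y y<k → h≡0 (suc y) (s≤s t≤y) (s≤s y<k)

sum≡sumFrom : ∀ {k} t (f : Fin k → ℕ) h →
  (∀ y → toℕ y ℕ.< t → f y ≡ 0) → (∀ y → t ≤ toℕ y → f y ≡ h (toℕ y)) →
  sum f ≡ sumFrom t k h
sum≡sumFrom {zero}  t       f h below above = refl
sum≡sumFrom {suc k} zero    f h below above =
  cong₂ _+_ (above zero z≤n) (sum≡sumFrom 0 (f ∘ suc) (h ∘ suc) (λ _ ()) (λ y _ → above (suc y) z≤n))
sum≡sumFrom {suc k} (suc t) f h below above =
  cong₂ _+_ (below zero (s≤s z≤n))
    (sum≡sumFrom t (f ∘ suc) (h ∘ suc) (λ y y<t → below (suc y) (s≤s y<t)) (λ y t≤y → above (suc y) (s≤s t≤y)))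

count-allVecs-suc : ∀ {n m} {P : Vec (Fin n) (suc m) → Set} (P? : Decidable P) →
  count P? (allVecs n (suc m)) ≡ sum (λ x → count (P? ∘ (x ∷_)) (allVecs n m))
count-allVecs-suc {n} {m} P? =
  trans (count-concatMap-tabulate P? (λ x → List.map (x ∷_) (allVecs n m)) (λ x → x))
        (sum-cong-≗ (λ x → count-map P? (x ∷_) (allVecs n m)))

count-allVecs-avoiding : ∀ {n m} (x : Fin (suc n)) {P : Vec (Fin (suc n)) m → Set} (P? : Decidable P) →
  (∀ w → P w → ∀ j → lookup w j ≢ x) →
  count P? (allVecs (suc n) m) ≡ count (P? ∘ Vec.map (punchIn x)) (allVecs n m)
count-allVecs-avoiding {m = zero}  x P? avoids with P? []
... | yes _ = refl
... | no _  = refl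
count-allVecs-avoiding {n} {suc m} x P? avoids = begin
  count P? (allVecs (suc n) (suc m))
    ≡⟨ count-allVecs-suc P? ⟩
  sum (λ z → count (P? ∘ (z ∷_)) (allVecs (suc n) m))
    ≡⟨ sum-remove {i = x} (λ z → count (P? ∘ (z ∷_)) (allVecs (suc n) m)) ⟩
  count (P? ∘ (x ∷_)) (allVecs (suc n) m) + sum (λ z → count (P? ∘ (punchIn x z ∷_)) (allVecs (suc n) m))
    ≡⟨ cong (_+ sum (λ z → count (P? ∘ (punchIn x z ∷_)) (allVecs (suc n) m)))
            (count-none (P? ∘ (x ∷_)) (λ w p → avoids (x ∷ w) p zero refl) (allVecs (suc n) m)) ⟩
  sum (λ z → count (P? ∘ (punchIn x z ∷_)) (allVecs (suc n) m))
    ≡⟨ sum-cong-≗ (λ z → count-allVecs-avoiding x (P? ∘ (punchIn x z ∷_)) (λ w p j → avoids _ p (suc j))) ⟩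
  sum (λ z → count (P? ∘ Vec.map (punchIn x) ∘ (z ∷_)) (allVecs n m))
    ≡⟨ count-allVecs-suc (P? ∘ Vec.map (punchIn x)) ⟨
  count (P? ∘ Vec.map (punchIn x)) (allVecs n (suc m)) ∎
  where open ≡-Reasoning

-- y ◂ w is the word starting with y whose remaining letters are order-isomorphic to w.
infixr 5 _◂_
_◂_ : ∀ {m} → Fin (suc m) → Word m → Word (suc m)
y ◂ w = y ∷ Vec.map (punchIn y) w

count-perms-by-head : ∀ {m} {P : Word (suc m) → Set} (P? : Decidable P) → (∀ σ → P σ → IsPerm σ) →
  count P? (allVecs (suc m) (suc m)) ≡ sum (λ y → count (P? ∘ (y ◂_)) (allVecs m m))
count-perms-by-head P? perm = trans (count-allVecs-suc P?) (sum-cong-≗ λ y →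
  count-allVecs-avoiding y (P? ∘ (y ∷_)) λ w p j wⱼ≡y → Finₚ.0≢1+n (perm (y ∷ w) p zero (suc j) (sym wⱼ≡y)))

perm-surjective : ∀ {k} (v : Word k) → IsPerm v → ∀ x → ∃ λ j → lookup v j ≡ x
perm-surjective {zero}  v _   ()
perm-surjective {suc k} v inj x with Finₚ.any? (λ j → lookup v j Fin.≟ x)
... | yes hit = hit
... | no miss = ⊥-elim (Finₚ.<⇒notInjective (n<1+n k) squeezed-injective)
  where
  squeezed : Fin (suc k) → Fin k
  squeezed j = Fin.punchOut {i = x} {j = lookup v j} λ x≡vⱼ → miss (j , sym x≡vⱼ)
  squeezed-injective : ∀ {a b} → squeezed a ≡ squeezed b → a ≡ b
  squeezed-injective {a} {b} eq = inj a b (Finₚ.punchOut-injective {i = x} _ _ eq)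

punchIn<i : ∀ {i : Fin (suc n)} {j : Fin n} → toℕ j ℕ.< toℕ i → punchIn i j Fin.< i
punchIn<i {i = suc i} {zero}  _         = s≤s z≤n
punchIn<i {i = suc i} {suc j} (s≤s j<i) = s≤s (punchIn<i j<i)

punchIn<i⁻¹ : ∀ {i : Fin (suc n)} {j : Fin n} → punchIn i j Fin.< i → toℕ j ℕ.< toℕ i
punchIn<i⁻¹ {i = suc i} {zero}  _         = s≤s z≤n
punchIn<i⁻¹ {i = suc i} {suc j} (s≤s j<i) = s≤s (punchIn<i⁻¹ j<i)

i<punchIn : ∀ {i : Fin (suc n)} {j : Fin n} → toℕ i ≤ toℕ j → i Fin.< punchIn i j
i<punchIn {i = zero}  _         = s≤s z≤n
i<punchIn {i = suc i} {suc j} (s≤s i≤j) = s≤s (i<punchIn i≤j)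

i<punchIn⁻¹ : ∀ {i : Fin (suc n)} {j : Fin n} → i Fin.< punchIn i j → toℕ i ≤ toℕ j
i<punchIn⁻¹ {i = zero}  _         = z≤n
i<punchIn⁻¹ {i = suc i} {suc j} (s≤s i<j) = s≤s (i<punchIn⁻¹ i<j)

punchIn-mono-< : ∀ (i : Fin (suc n)) {j k : Fin n} → j Fin.< k → punchIn i j Fin.< punchIn i k
punchIn-mono-< zero    j<k                         = s≤s j<k
punchIn-mono-< (suc i) {zero}  {suc k} _           = s≤s z≤n
punchIn-mono-< (suc i) {suc j} {suc k} (s≤s j<k)   = s≤s (punchIn-mono-< i j<k)

punchIn-cancel-< : ∀ (i : Fin (suc n)) {j k : Fin n} → punchIn i j Fin.< punchIn i k → j Fin.< k
punchIn-cancel-< zero    (s≤s j<k)                 = j<k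
punchIn-cancel-< (suc i) {zero}  {suc k} _         = s≤s z≤n
punchIn-cancel-< (suc i) {suc j} {suc k} (s≤s j<k) = s≤s (punchIn-cancel-< i j<k)

-- Permutations whose small values are right-to-left minima

RLMinBelow : ℕ → Word n → Set
RLMinBelow {n} t σ = (a b : Fin n) → a Fin.< b → lookup σ b Fin.< lookup σ a → t ≤ toℕ (lookup σ a)

Above : ℕ → ℕ → Word n → Set
Above {n} t K σ = (j : Fin n) → toℕ j ℕ.< K → t ≤ toℕ (lookup σ j)

Increasing : ℕ → Word n → Set
Increasing {n} K σ = (a b : Fin n) → a Fin.< b → toℕ b ℕ.< K → lookup σ a Fin.< lookup σ b

Core : ℕ → Word n → Set
Core t σ = IsPerm σ × Avoids321 σ × RLMinBelow t σ

Good : ℕ → ℕ → Word n → Set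
Good t K σ = Core t σ × Above t K σ × Increasing K σ

rlMinBelow? : ∀ t → Decidable (RLMinBelow {n} t)
rlMinBelow? t σ = all? λ a → all? λ b → (a <? b) →-dec (lookup σ b <? lookup σ a) →-dec (t ℕ.≤? toℕ (lookup σ a))

above? : ∀ t K → Decidable (Above {n} t K)
above? t K σ = all? λ j → (toℕ j ℕ.<? K) →-dec (t ℕ.≤? toℕ (lookup σ j))

increasing? : ∀ K → Decidable (Increasing {n} K)
increasing? K σ = all? λ a → all? λ b → (a <? b) →-dec (toℕ b ℕ.<? K) →-dec (lookup σ a <? lookup σ b)

good? : ∀ t K → Decidable (Good {n} t K)
good? t K σ = (isPerm? σ ×-dec ¬? (has321? σ) ×-dec rlMinBelow? t σ) ×-dec above? t K σ ×-dec increasing? K σ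

#Good : ℕ → ℕ → ℕ → ℕ
#Good m t K = count (good? t K) (allVecs m m)

module Prepend {m} (y : Fin (suc m)) (w : Word m) where

  σ : Word (suc m)
  σ = y ◂ w

  σ-suc : ∀ j → lookup σ (suc j) ≡ punchIn y (lookup w j)
  σ-suc j = lookup-map j (punchIn y) w

  ◂-mono : ∀ {a b} → lookup w a Fin.< lookup w b → lookup σ (suc a) Fin.< lookup σ (suc b)
  ◂-mono {a} {b} lt = subst₂ Fin._<_ (sym (σ-suc a)) (sym (σ-suc b)) (punchIn-mono-< y lt)

  ◂-cancel : ∀ {a b} → lookup σ (suc a) Fin.< lookup σ (suc b) → lookup w a Fin.< lookup w b
  ◂-cancel {a} {b} lt = punchIn-cancel-< y (subst₂ Fin._<_ (σ-suc a) (σ-suc b) lt)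

  ◂<y : ∀ {b} → toℕ (lookup w b) ℕ.< toℕ y → lookup σ (suc b) Fin.< y
  ◂<y {b} lt = subst (Fin._< y) (sym (σ-suc b)) (punchIn<i lt)

  ◂<y⁻¹ : ∀ {b} → lookup σ (suc b) Fin.< y → toℕ (lookup w b) ℕ.< toℕ y
  ◂<y⁻¹ {b} lt = punchIn<i⁻¹ (subst (Fin._< y) (σ-suc b) lt)

  y<◂ : ∀ {b} → toℕ y ≤ toℕ (lookup w b) → y Fin.< lookup σ (suc b)
  y<◂ {b} le = subst (y Fin.<_) (sym (σ-suc b)) (i<punchIn le)

  y<◂⁻¹ : ∀ {b} → y Fin.< lookup σ (suc b) → toℕ y ≤ toℕ (lookup w b)
  y<◂⁻¹ {b} lt = i<punchIn⁻¹ (subst (y Fin.<_) (σ-suc b) lt)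

  isPerm⁻ : IsPerm σ → IsPerm w
  isPerm⁻ inj a b eq = Finₚ.suc-injective (inj (suc a) (suc b) (begin
    lookup σ (suc a)        ≡⟨ σ-suc a ⟩
    punchIn y (lookup w a)  ≡⟨ cong (punchIn y) eq ⟩
    punchIn y (lookup w b)  ≡⟨ σ-suc b ⟨
    lookup σ (suc b)        ∎))
    where open ≡-Reasoning

  isPerm⁺ : IsPerm w → IsPerm σ
  isPerm⁺ inj zero    zero    eq = refl
  isPerm⁺ inj zero    (suc b) eq = ⊥-elim (Finₚ.punchInᵢ≢i y (lookup w b) (sym (trans eq (σ-suc b))))
  isPerm⁺ inj (suc a) zero    eq = ⊥-elim (Finₚ.punchInᵢ≢i y (lookup w a) (trans (sym (σ-suc a)) eq))
  isPerm⁺ inj (suc a) (suc b) eq =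
    cong suc (inj a b (Finₚ.punchIn-injective y _ _ (trans (sym (σ-suc a)) (trans eq (σ-suc b)))))

  -- The 321s through the head are y > wₐ > w_b; excluding them says every wₐ < y is a right-to-left minimum of w.
  avoids321⁻ : Avoids321 σ → Avoids321 w × RLMinBelow (toℕ y) w
  avoids321⁻ avoid =
    (λ (a , b , c , a<b , b<c , p , q) → avoid (suc a , suc b , suc c , s≤s a<b , s≤s b<c , ◂-mono p , ◂-mono q)) ,
    λ a b a<b wb<wa → ≮⇒≥ λ wa<y → avoid (zero , suc a , suc b , s≤s z≤n , s≤s a<b , ◂<y wa<y , ◂-mono wb<wa)

  avoids321⁺ : Avoids321 w → RLMinBelow (toℕ y) w → Avoids321 σ
  avoids321⁺ avoid rl (zero  , suc b , suc c , _ , s≤s b<c , σb<y , σc<σb) =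
    ≤⇒≯ (rl b c b<c (◂-cancel σc<σb)) (◂<y⁻¹ σb<y)
  avoids321⁺ avoid rl (suc a , suc b , suc c , s≤s a<b , s≤s b<c , p , q) =
    avoid (a , b , c , a<b , b<c , ◂-cancel p , ◂-cancel q)

  rlMinBelow⁺ : ∀ {t} → t ≤ toℕ y → RLMinBelow (toℕ y) w → RLMinBelow t σ
  rlMinBelow⁺ t≤y rl zero    (suc b) _         _ = t≤y
  rlMinBelow⁺ t≤y rl (suc a) (suc b) (s≤s a<b) p = ≤-trans t≤y (<⇒≤ (y<◂ (rl a b a<b (◂-cancel p))))

  -- An entry 0 < y < t at the head is not a right-to-left minimum: the value 0 occurs after it.
  ¬rlMinBelow : ∀ {t} → 0 ℕ.< toℕ y → toℕ y ℕ.< t → IsPerm w → ¬ RLMinBelow t σ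
  ¬rlMinBelow 0<y y<t inj rl with perm-surjective σ (isPerm⁺ inj) zero
  ... | zero  , y≡0  = n≮0 (subst (λ v → 0 ℕ.< toℕ v) y≡0 0<y)
  ... | suc j , σj≡0 = <⇒≱ y<t (rl zero (suc j) (s≤s z≤n) (subst (Fin._< y) (sym σj≡0) 0<y))

  core⁻ : ∀ {t} → Core t σ → Core (toℕ y) w
  core⁻ (inj , avoid , _) = isPerm⁻ inj , avoids321⁻ avoid

  core⁺ : ∀ {t} → t ≤ toℕ y → Core (toℕ y) w → Core t σ
  core⁺ t≤y (inj , avoid , rl) = isPerm⁺ inj , avoids321⁺ avoid rl , rlMinBelow⁺ t≤y rl

  rising⁻ : ∀ {t K} → Above t (suc K) σ → Increasing (suc K) σ →
    t ≤ toℕ y × Above (toℕ y) K w × Increasing K w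
  rising⁻ above incr =
    above zero (s≤s z≤n) ,
    (λ j j<K → y<◂⁻¹ (incr zero (suc j) (s≤s z≤n) (s≤s j<K))) ,
    λ a b a<b b<K → ◂-cancel (incr (suc a) (suc b) (s≤s a<b) (s≤s b<K))

  rising⁺ : ∀ {t K} → t ≤ toℕ y → Above (toℕ y) K w → Increasing K w →
    Above t (suc K) σ × Increasing (suc K) σ
  rising⁺ {t} {K} t≤y above incr = above′ , incr′
    where
    above′ : Above t (suc K) σ
    above′ zero    _         = t≤y
    above′ (suc j) (s≤s j<K) = ≤-trans t≤y (<⇒≤ (y<◂ (above j j<K)))
    incr′ : Increasing (suc K) σ
    incr′ zero    (suc b) _         (s≤s b<K) = y<◂ (above b b<K)
    incr′ (suc a) (suc b) (s≤s a<b) (s≤s b<K) = ◂-mono (incr a b a<b b<K)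

rlMinBelow-zero◂⁻ : ∀ {m t} (w : Word m) → RLMinBelow (suc t) (zero ◂ w) → RLMinBelow t w
rlMinBelow-zero◂⁻ {t = t} w rl a b a<b wb<wa =
  ℕ.s≤s⁻¹ (subst (suc t ≤_) (cong toℕ (σ-suc a)) (rl (suc a) (suc b) (s≤s a<b) (◂-mono wb<wa)))
  where open Prepend zero w

rlMinBelow-zero◂⁺ : ∀ {m t} (w : Word m) → RLMinBelow t w → RLMinBelow (suc t) (zero ◂ w)
rlMinBelow-zero◂⁺     w rl zero    (suc b) _         p = ⊥-elim (n≮0 p)
rlMinBelow-zero◂⁺ {t = t} w rl (suc a) (suc b) (s≤s a<b) p =
  subst (suc t ≤_) (sym (cong toℕ (σ-suc a))) (s≤s (rl a b a<b (◂-cancel p)))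
  where open Prepend zero w

good⇒isPerm : ∀ {t K} (σ : Word n) → Good t K σ → IsPerm σ
good⇒isPerm _ ((inj , _) , _) = inj

module _ {m : ℕ} where

  count-◂-above : ∀ {t} K (y : Fin (suc m)) → t ≤ toℕ y →
    count (good? t K ∘ (y ◂_)) (allVecs m m) ≡ #Good m (toℕ y) (ℕ.pred K)
  count-◂-above zero    y t≤y = count-cong _ _ (λ w → let open Prepend y w in mk⇔
    (λ (core , _) → core⁻ core , (λ _ ()) , (λ _ _ _ ()))
    (λ (core , _) → core⁺ t≤y core , (λ _ ()) , (λ _ _ _ ()))) (allVecs m m)
  count-◂-above (suc K) y t≤y = count-cong _ _ (λ w → let open Prepend y w in mk⇔
    (λ (core , above , incr) → core⁻ core , proj₂ (rising⁻ above incr))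
    (λ (core , above , incr) → core⁺ t≤y core , rising⁺ t≤y above incr)) (allVecs m m)

  count-◂-below-rising : ∀ {t K} (y : Fin (suc m)) → toℕ y ℕ.< t →
    count (good? t (suc K) ∘ (y ◂_)) (allVecs m m) ≡ 0
  count-◂-below-rising y y<t = count-none _ (λ w (_ , above , _) → <⇒≱ y<t (above zero (s≤s z≤n))) (allVecs m m)

  count-◂-below-nonzero : ∀ {t K} (y : Fin (suc m)) → 0 ℕ.< toℕ y → toℕ y ℕ.< t →
    count (good? t K ∘ (y ◂_)) (allVecs m m) ≡ 0
  count-◂-below-nonzero y 0<y y<t = count-none _ (λ w ((inj , _ , rl) , _) → let open Prepend y w in
    ¬rlMinBelow 0<y y<t (isPerm⁻ inj) rl) (allVecs m m)

  count-zero◂ : ∀ {s} → count (good? (suc s) 0 ∘ (zero ◂_)) (allVecs m m) ≡ #Good m s 0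
  count-zero◂ = count-cong _ _ (λ w → let open Prepend zero w in mk⇔
    (λ ((inj , avoid , rl) , _) →
      (isPerm⁻ inj , proj₁ (avoids321⁻ avoid) , rlMinBelow-zero◂⁻ w rl) , (λ _ ()) , (λ _ _ _ ()))
    (λ ((inj , avoid , rl) , _) →
      (isPerm⁺ inj , avoids321⁺ avoid (λ _ _ _ _ → z≤n) , rlMinBelow-zero◂⁺ w rl) , (λ _ ()) , (λ _ _ _ ())))
    (allVecs m m)

#Good-head : ∀ m t K → #Good (suc m) t (suc K) ≡ sumFrom t (suc m) (λ y → #Good m y K)
#Good-head m t K = trans (count-perms-by-head {m} (good? t (suc K)) good⇒isPerm)
  (sum≡sumFrom t _ _ (count-◂-below-rising {m}) (count-◂-above {m} (suc K)))

#Good-head-0 : ∀ m → #Good (suc m) 0 0 ≡ sumFrom 0 (suc m) (λ y → #Good m y 0)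
#Good-head-0 m = trans (count-perms-by-head {m} (good? 0 0) good⇒isPerm)
  (sum≡sumFrom 0 _ (λ y → #Good m y 0) (λ _ ()) (count-◂-above {m} 0))

#Good-head-suc : ∀ m s → #Good (suc m) (suc s) 0 ≡ #Good m s 0 + sumFrom (suc s) (suc m) (λ y → #Good m y 0)
#Good-head-suc m s = trans (count-perms-by-head {m} (good? (suc s) 0) good⇒isPerm)
  (cong₂ _+_ (count-zero◂ {m}) (sum≡sumFrom s _ _
    (λ y y<s → count-◂-below-nonzero {m} (suc y) (s≤s z≤n) (s≤s y<s))
    (λ y s≤y → count-◂-above {m} 0 (suc y) (s≤s s≤y))))

#Good-rising-step : ∀ {m t} K → t ≤ m → #Good (suc m) t (suc K) ≡ #Good m t K + #Good (suc m) (suc t) (suc K)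
#Good-rising-step {m} {t} K t≤m = begin
  #Good (suc m) t (suc K)                                       ≡⟨ #Good-head m t K ⟩
  sumFrom t (suc m) (λ y → #Good m y K)                          ≡⟨ sumFrom-step (λ y → #Good m y K) (s≤s t≤m) ⟩
  #Good m t K + sumFrom (suc t) (suc m) (λ y → #Good m y K)      ≡⟨ cong (#Good m t K +_) (#Good-head m (suc t) K) ⟨
  #Good m t K + #Good (suc m) (suc t) (suc K)                   ∎
  where open ≡-Reasoning

#Good-0≡1 : ∀ m → #Good (suc m) 0 0 ≡ #Good (suc m) 1 0
#Good-0≡1 m = trans (#Good-head-0 m) (sym (#Good-head-suc m 0))

#Good-suc-step : ∀ {m s} → s ℕ.< m → #Good (suc m) (suc s) 0 ≡ #Good m s 0 + #Good (suc m) (2 + s) 0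
#Good-suc-step {m} {s} s<m = begin
  #Good (suc m) (suc s) 0
    ≡⟨ #Good-head-suc m s ⟩
  #Good m s 0 + sumFrom (suc s) (suc m) h
    ≡⟨ cong (#Good m s 0 +_) (sumFrom-step h (s≤s s<m)) ⟩
  #Good m s 0 + (#Good m (suc s) 0 + sumFrom (2 + s) (suc m) h)
    ≡⟨ cong (#Good m s 0 +_) (#Good-head-suc m (suc s)) ⟨
  #Good m s 0 + #Good (suc m) (2 + s) 0 ∎
  where
  open ≡-Reasoning
  h : ℕ → ℕ
  h y = #Good m y 0

#Good-diagonal-suc : ∀ m → #Good (suc m) (suc m) 0 ≡ #Good m m 0
#Good-diagonal-suc m = begin
  #Good (suc m) (suc m) 0                     ≡⟨ #Good-head-suc m m ⟩
  #Good m m 0 + sumFrom (suc m) (suc m) h     ≡⟨ cong (#Good m m 0 +_) (sumFrom-≡0 (suc m) (suc m) h λ y m<y y≤m → ⊥-elim (<⇒≱ y≤m m<y)) ⟩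
  #Good m m 0 + 0                             ≡⟨ +-identityʳ _ ⟩
  #Good m m 0                                 ∎
  where
  open ≡-Reasoning
  h : ℕ → ℕ
  h y = #Good m y 0

#Good-diagonal : ∀ m → #Good m m 0 ≡ 1
#Good-diagonal zero    = refl
#Good-diagonal (suc m) = trans (#Good-diagonal-suc m) (#Good-diagonal m)

#Good-subdiagonal : ∀ m → #Good (suc m) m 0 ≡ suc m
#Good-subdiagonal zero    = refl
#Good-subdiagonal (suc m) = begin
  #Good (2 + m) (suc m) 0                       ≡⟨ #Good-suc-step (n<1+n m) ⟩
  #Good (suc m) m 0 + #Good (2 + m) (2 + m) 0   ≡⟨ cong₂ _+_ (#Good-subdiagonal m) (#Good-diagonal (2 + m)) ⟩
  suc m + 1                                     ≡⟨ +-comm (suc m) 1 ⟩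
  2 + m                                         ∎
  where open ≡-Reasoning

#Good-vanish : ∀ m t K → K ≤ m → m ℕ.< t + K → #Good (suc m) t (suc K) ≡ 0
#Good-vanish m t zero _ m<t+0 = trans (#Good-head m t 0) (sumFrom-≡0 t (suc m) _ λ y t≤y y<m+1 →
  ⊥-elim (<⇒≱ m<t+0 (subst (_≤ m) (sym (+-identityʳ t)) (≤-trans t≤y (ℕ.s≤s⁻¹ y<m+1)))))
#Good-vanish (suc m) t (suc K) (s≤s K≤m) m+1<t+K+1 = trans (#Good-head (suc m) t (suc K)) (sumFrom-≡0 t (2 + m) _ λ y t≤y _ →
  #Good-vanish m y K K≤m (<-≤-trans (ℕ.s≤s⁻¹ (subst (suc m ℕ.<_) (+-suc t K) m+1<t+K+1)) (+-monoˡ-≤ K t≤y)))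

#Good-shift : ∀ K m t → t + K ≤ m → #Good m t K ≡ #Good m (t + K) 0
#Good-shift zero    m       t _   = cong (λ s → #Good m s 0) (sym (+-identityʳ t))
#Good-shift (suc K) zero    t t+K+1≤0 = ⊥-elim (<⇒≱ (s≤s z≤n) (subst (_≤ 0) (+-suc t K) t+K+1≤0))
#Good-shift (suc K) (suc m) t t+K+1≤m+1 = down (m ∸ (t + K)) t (m∸n+n≡m t+K≤m)
  where
  open ≡-Reasoning
  t+K≤m : t + K ≤ m
  t+K≤m = ℕ.s≤s⁻¹ (subst (_≤ suc m) (+-suc t K) t+K+1≤m+1)
  down : ∀ d t → d + (t + K) ≡ m → #Good (suc m) t (suc K) ≡ #Good (suc m) (t + suc K) 0
  down zero t t+K≡m = begin
    #Good (suc m) t (suc K)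
      ≡⟨ #Good-rising-step K (≤-trans (m≤m+n t K) (≤-reflexive t+K≡m)) ⟩
    #Good m t K + #Good (suc m) (suc t) (suc K)
      ≡⟨ cong₂ _+_ (#Good-shift K m t (≤-reflexive t+K≡m))
                   (#Good-vanish m (suc t) K K≤m (s≤s (≤-reflexive (sym t+K≡m)))) ⟩
    #Good m (t + K) 0 + 0
      ≡⟨ +-identityʳ _ ⟩
    #Good m (t + K) 0
      ≡⟨ cong (λ s → #Good m s 0) t+K≡m ⟩
    #Good m m 0
      ≡⟨ #Good-diagonal-suc m ⟨
    #Good (suc m) (suc m) 0
      ≡⟨ cong (λ s → #Good (suc m) s 0) (trans (cong suc (sym t+K≡m)) (sym (+-suc t K))) ⟩
    #Good (suc m) (t + suc K) 0 ∎
    where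
    K≤m : K ≤ m
    K≤m = ≤-trans (m≤n+m K t) (≤-reflexive t+K≡m)
  down (suc d) t gap≡m = begin
    #Good (suc m) t (suc K)
      ≡⟨ #Good-rising-step K (≤-trans (m≤m+n t K) (<⇒≤ t+K<m)) ⟩
    #Good m t K + #Good (suc m) (suc t) (suc K)
      ≡⟨ cong₂ _+_ (#Good-shift K m t (<⇒≤ t+K<m)) (down d (suc t) (trans (+-suc d (t + K)) gap≡m)) ⟩
    #Good m (t + K) 0 + #Good (suc m) (suc t + suc K) 0
      ≡⟨ cong (λ s → #Good m (t + K) 0 + #Good (suc m) (suc s) 0) (+-suc t K) ⟩
    #Good m (t + K) 0 + #Good (suc m) (2 + (t + K)) 0
      ≡⟨ #Good-suc-step t+K<m ⟨
    #Good (suc m) (suc (t + K)) 0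
      ≡⟨ cong (λ s → #Good (suc m) s 0) (+-suc t K) ⟨
    #Good (suc m) (t + suc K) 0 ∎
    where
    t+K<m : t + K ℕ.< m
    t+K<m = subst (t + K ℕ.<_) gap≡m (s≤s (m≤n+m (t + K) d))

increasing⇒ltrMax : ∀ {K} (σ : Word n) → Increasing K σ → ∀ j → toℕ j ℕ.< K → LTRMax σ j
increasing⇒ltrMax σ incr j j<K k k<j = incr k j k<j j<K

ltrMax⇒increasing : ∀ {K} (σ : Word n) → (∀ j → toℕ j ℕ.< K → LTRMax σ j) → Increasing K σ
ltrMax⇒increasing σ ltr a b a<b b<K = ltr b b<K a a<b

increasing-suc : ∀ {K} (σ : Word n) → Increasing K σ → (∀ j → toℕ j ≡ K → LTRMax σ j) → Increasing (suc K) σ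
increasing-suc {K = K} σ incr ltrₖ = ltrMax⇒increasing σ ltr
  where
  ltr : ∀ j → toℕ j ℕ.< suc K → LTRMax σ j
  ltr j j<K+1 with m≤n⇒m<n∨m≡n (ℕ.s≤s⁻¹ j<K+1)
  ... | inj₁ j<K = increasing⇒ltrMax σ incr j j<K
  ... | inj₂ j≡K = ltrₖ j j≡K

counted⇔ : ∀ {K} (σ : Word n) → 2 + K ≤ n →
  Counted (2 + K) σ ⇔ (Good 0 (suc K) σ × ¬ Increasing (2 + K) σ)
counted⇔ {n} {K} σ K+2≤n = mk⇔
  (λ (inj , avoid , prefix , last) →
    ((inj , avoid , λ _ _ _ _ → z≤n) , (λ _ _ → z≤n) , ltrMax⇒increasing σ (λ j j<K+1 → prefix j (s≤s j<K+1))) ,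
    λ incr → last j (cong suc toℕj≡K+1) (increasing⇒ltrMax σ incr j (subst (ℕ._< 2 + K) (sym toℕj≡K+1) (n<1+n (suc K)))))
  (λ (((inj , avoid , _) , _ , incr) , ¬incr) →
    inj , avoid , (λ j j<K+2 → increasing⇒ltrMax σ incr j (ℕ.s≤s⁻¹ j<K+2)) ,
    λ i i+1≡K+2 ltr → ¬incr (increasing-suc σ incr λ k k≡K+1 →
      subst (LTRMax σ) (Finₚ.toℕ-injective (trans (suc-injective i+1≡K+2) (sym k≡K+1))) ltr))
  where
  j : Fin n
  j = Fin.fromℕ< K+2≤n
  toℕj≡K+1 : toℕ j ≡ suc K
  toℕj≡K+1 = Finₚ.toℕ-fromℕ< K+2≤n

good0-suc⇔ : ∀ {K} (σ : Word n) → Good 0 (2 + K) σ ⇔ (Good 0 (suc K) σ × Increasing (2 + K) σ)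
good0-suc⇔ σ = mk⇔
  (λ (core , _ , incr) → (core , (λ _ _ → z≤n) , λ a b a<b b<K+1 → incr a b a<b (m<n⇒m<1+n b<K+1)) , incr)
  (λ ((core , _) , incr) → core , (λ _ _ → z≤n) , incr)

g+#Good : ∀ {n K} → 2 + K ≤ n → g n (2 + K) + #Good n 0 (2 + K) ≡ #Good n 0 (suc K)
g+#Good {n} {K} K+2≤n = begin
  g n (2 + K) + #Good n 0 (2 + K)
    ≡⟨ +-comm (g n (2 + K)) _ ⟩
  #Good n 0 (2 + K) + g n (2 + K)
    ≡⟨ cong₂ _+_ (count-cong _ (good? 0 (suc K) ∩? increasing? (2 + K)) good0-suc⇔ (allVecs n n))
                 (count-cong _ (good? 0 (suc K) ∩? ∁? (increasing? (2 + K))) (λ σ → counted⇔ σ K+2≤n) (allVecs n n)) ⟩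
  count (good? 0 (suc K) ∩? increasing? (2 + K)) (allVecs n n) + count (good? 0 (suc K) ∩? ∁? (increasing? (2 + K))) (allVecs n n)
    ≡⟨ count-partition (good? 0 (suc K)) (increasing? (2 + K)) (allVecs n n) ⟨
  #Good n 0 (suc K) ∎
  where open ≡-Reasoning

g≡#Good : ∀ {m K} → K ℕ.< m → g (suc m) (2 + K) ≡ #Good m K 0
g≡#Good {m} {K} K<m = +-cancelʳ-≡ (#Good (suc m) (2 + K) 0) _ _ (begin
  g (suc m) (2 + K) + #Good (suc m) (2 + K) 0        ≡⟨ cong (g (suc m) (2 + K) +_) (#Good-shift (2 + K) (suc m) 0 (s≤s K<m)) ⟨
  g (suc m) (2 + K) + #Good (suc m) 0 (2 + K)        ≡⟨ g+#Good (s≤s K<m) ⟩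
  #Good (suc m) 0 (suc K)                            ≡⟨ #Good-shift (suc K) (suc m) 0 (s≤s (<⇒≤ K<m)) ⟩
  #Good (suc m) (suc K) 0                            ≡⟨ #Good-suc-step K<m ⟩
  #Good m K 0 + #Good (suc m) (2 + K) 0              ∎)
  where open ≡-Reasoning

-- Ballot and Catalan numbers

-- #Good (t + u) t 0 is the ballot number C(t+2u, u) - C(t+2u, u-1), the second term written as C(t+2u, t+u+1).
ballot : ∀ u t → #Good (t + u) t 0 + (t + u + u) C suc (t + u) ≡ (t + u + u) C u
ballot zero t rewrite +-identityʳ t | +-identityʳ t = cong₂ _+_ (#Good-diagonal t) (k>n⇒nCk≡0 (n<1+n t))
ballot (suc u) zero = subst (λ n → #Good (suc u) 0 0 + suc n C suc (suc u) ≡ suc n C suc u) (sym (+-suc u u)) (begin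
  #Good (suc u) 0 0 + suc m C suc (suc u)
    ≡⟨ cong₂ _+_ (#Good-0≡1 u) (sym (nCk+nC[k+1]≡[n+1]C[k+1] m (suc u))) ⟩
  #Good (suc u) 1 0 + (m C suc u + m C suc (suc u))
    ≡⟨ x∙yz≈y∙xz (#Good (suc u) 1 0) (m C suc u) (m C suc (suc u)) ⟩
  m C suc u + (#Good (suc u) 1 0 + m C suc (suc u))
    ≡⟨ cong (m C suc u +_) (ballot u 1) ⟩
  m C suc u + m C u
    ≡⟨ +-comm (m C suc u) _ ⟩
  m C u + m C suc u
    ≡⟨ nCk+nC[k+1]≡[n+1]C[k+1] m u ⟩
  suc m C suc u ∎)
  where
  open ≡-Reasoning
  m : ℕ
  m = suc (u + u)
ballot (suc u) (suc t) = begin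
  #Good (suc k) (suc t) 0 + suc N C suc (suc k)
    ≡⟨ cong₂ _+_ (#Good-suc-step (m<m+n t (s≤s z≤n))) (sym (nCk+nC[k+1]≡[n+1]C[k+1] N (suc k))) ⟩
  (#Good k t 0 + #Good (suc k) (2 + t) 0) + (N C suc k + N C suc (suc k))
    ≡⟨ interchange (#Good k t 0) (#Good (suc k) (2 + t) 0) (N C suc k) (N C suc (suc k)) ⟩
  (#Good k t 0 + N C suc k) + (#Good (suc k) (2 + t) 0 + N C suc (suc k))
    ≡⟨ cong₂ _+_ (ballot (suc u) t) shifted ⟩
  N C suc u + N C u
    ≡⟨ +-comm (N C suc u) _ ⟩
  N C u + N C suc u
    ≡⟨ nCk+nC[k+1]≡[n+1]C[k+1] N u ⟩
  suc N C suc u ∎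
  where
  open ≡-Reasoning
  k N : ℕ
  k = t + suc u
  N = t + suc u + suc u
  shifted : #Good (suc k) (2 + t) 0 + N C suc (suc k) ≡ N C u
  shifted = subst₂ (λ k′ n′ → #Good k′ (2 + t) 0 + n′ C suc k′ ≡ n′ C u)
    (cong suc (sym (+-suc t u)))
    (trans (cong (λ x → suc (x + u)) (sym (+-suc t u))) (sym (+-suc (t + suc u) u)))
    (ballot u (2 + t))

absorption : ∀ n k → suc k * (suc n C suc k) ≡ suc n * (n C k)
absorption zero    zero    = refl
absorption zero    (suc k) = *-zeroʳ (2 + k)
absorption (suc n) zero    = trans (*-identityˡ _) (trans (nC1≡n (2 + n)) (sym (*-identityʳ _)))
absorption (suc n) (suc k) = begin
  (2 + k) * ((2 + n) C (2 + k))
    ≡⟨ cong ((2 + k) *_) (nCk+nC[k+1]≡[n+1]C[k+1] (suc n) (suc k)) ⟨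
  (2 + k) * (a + b)
    ≡⟨ rearrange k a b ⟩
  a + (1 + k) * ((1 + n) C (1 + k)) + (2 + k) * ((1 + n) C (2 + k)) ≡⟨ cong₂ (λ x y → a + x + y) (absorption n k) (absorption n (suc k)) ⟩
  a + (1 + n) * (n C k) + (1 + n) * (n C (1 + k))
    ≡⟨ collect n a (n C k) (n C (1 + k)) ⟩
  a + (1 + n) * (n C k + n C (1 + k))
    ≡⟨ cong (λ x → a + (1 + n) * x) (nCk+nC[k+1]≡[n+1]C[k+1] n k) ⟩
  (2 + n) * a ∎
  where
  open ≡-Reasoning
  a b : ℕ
  a = (1 + n) C (1 + k)
  b = (1 + n) C (2 + k)
  rearrange : ∀ k x y → (2 + k) * (x + y) ≡ x + (1 + k) * x + (2 + k) * y
  rearrange = solve-∀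
  collect : ∀ n x y z → x + (1 + n) * y + (1 + n) * z ≡ x + (1 + n) * (y + z)
  collect = solve-∀

#Good≡catalan : ∀ m → #Good m 0 0 ≡ catalan m
#Good≡catalan zero    = refl
#Good≡catalan (suc r) = begin
  #Good M 0 0                    ≡⟨ m*n/n≡m (#Good M 0 0) (suc M) ⟨
  #Good M 0 0 * suc M / suc M    ≡⟨ cong (_/ suc M) (+-cancelʳ-≡ (M * X) (#Good M 0 0 * suc M) X scaled) ⟩
  X / suc M                      ∎
  where
  open ≡-Reasoning
  M X Y N : ℕ
  M = suc r
  X = (M + M) C M
  Y = (M + M) C suc M
  N = r + suc r
  Y-vs-X : suc M * Y ≡ M * X
  Y-vs-X = begin
    suc M * (suc N C suc M)   ≡⟨ absorption N M ⟩
    suc N * (N C M)           ≡⟨ cong (suc N *_) (nCk≡nC[n∸k] (m≤n+m M r)) ⟩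
    suc N * (N C (N ∸ M))     ≡⟨ cong (λ x → suc N * (N C x)) (m+n∸n≡m r M) ⟩
    suc N * (N C r)           ≡⟨ absorption N r ⟨
    M * (suc N C M)           ∎
  scaled : #Good M 0 0 * suc M + M * X ≡ X + M * X
  scaled = begin
    #Good M 0 0 * suc M + M * X          ≡⟨ cong₂ _+_ (*-comm (#Good M 0 0) (suc M)) (sym Y-vs-X) ⟩
    suc M * #Good M 0 0 + suc M * Y      ≡⟨ *-distribˡ-+ (suc M) (#Good M 0 0) Y ⟨
    suc M * (#Good M 0 0 + Y)            ≡⟨ cong (suc M *_) (ballot M 0) ⟩
    suc M * X                            ∎

g-recurrence : ∀ {m K} → 3 + K ≤ m → g (suc m) (3 + K) ≡ g m (2 + K) + g (suc m) (4 + K)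
g-recurrence {suc m} {K} (s≤s K+2≤m) = begin
  g (2 + m) (3 + K)                           ≡⟨ g≡#Good (s≤s (<⇒≤ K+2≤m)) ⟩
  #Good (suc m) (suc K) 0                     ≡⟨ #Good-suc-step K<m ⟩
  #Good m K 0 + #Good (suc m) (2 + K) 0       ≡⟨ cong₂ _+_ (g≡#Good K<m) (g≡#Good (s≤s K+2≤m)) ⟨
  g (suc m) (2 + K) + g (2 + m) (4 + K)       ∎
  where
  open ≡-Reasoning
  K<m : K ℕ.< m
  K<m = <-trans (n<1+n K) K+2≤m

proposition4p12 : (n : ℕ) → 2 ≤ n →
    (g n 2 ≡ catalan (n ∸ 1)) ×
    (g n n ≡ n ∸ 1) ×
    ((i : ℕ) → 3 ≤ i → i ≤ n ∸ 1 → g n i ≡ g (n ∸ 1) (i ∸ 1) + g n (i + 1))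
proposition4p12 (suc (suc m)) (s≤s (s≤s z≤n)) = first , last , middle
  where
  first : g (2 + m) 2 ≡ catalan (suc m)
  first = trans (g≡#Good {suc m} (s≤s z≤n)) (#Good≡catalan (suc m))
  last : g (2 + m) (2 + m) ≡ suc m
  last = trans (g≡#Good (n<1+n m)) (#Good-subdiagonal m)
  middle : ∀ i → 3 ≤ i → i ≤ suc m → g (2 + m) i ≡ g (suc m) (i ∸ 1) + g (2 + m) (i + 1)
  middle (suc (suc (suc K))) (s≤s (s≤s (s≤s z≤n))) i≤m+1 =
    trans (g-recurrence i≤m+1) (cong (λ i′ → g (suc m) (2 + K) + g (2 + m) i′) (+-comm 1 (3 + K)))
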